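{- For $n\ge3$, the number of Motzkin paths of length $n$ with exactly two plateaus equals $(n-3)n2^{n-6}$.
   Context: A Motzkin path of length $n$ is a sequence of $n$ steps $U$ ($+1$), $F$ ($0$), $D$ ($-1$) starting and ending at height $0$ and never going below $0$. A plateau is an occurrence of a consecutive subword $UF^kD$ for some $k\ge0$. -}

module Defs where

open import Data.Nat using (ℕ; zero; suc; _+_)
open import Data.Bool using (Bool; true; false; _∧_)
open import Data.List using (List; []; _∷_; length; map; concatMap; filter)
open import Relation.Binary.PropositionalEquality using (_≡_)
open import Relation.Nullary using (Dec; yes; no)
open import Data.Bool using (T)
open import Relation.Nullary.Decidable using (T?)

-- Steps of a Motzkin path: U = +1, F = 0, D = -1
data Step : Set where
  U F D : Step

words : ℕ → List (List Step)
words zero = [] ∷ []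
words (suc n) = concatMap (λ w → (U ∷ w) ∷ (F ∷ w) ∷ (D ∷ w) ∷ []) (words n)

validFrom : ℕ → List Step → Bool
validFrom zero [] = true
validFrom (suc h) [] = false
validFrom h (U ∷ w) = validFrom (suc h) w
validFrom h (F ∷ w) = validFrom h w
validFrom zero (D ∷ w) = false
validFrom (suc h) (D ∷ w) = validFrom h w

isMotzkin : List Step → Bool
isMotzkin = validFrom zero

startsFkD : List Step → Bool
startsFkD [] = false
startsFkD (U ∷ _) = false
startsFkD (F ∷ w) = startsFkD w
startsFkD (D ∷ _) = true

plateaus : List Step → ℕ
plateaus [] = 0
plateaus (U ∷ w) = (if startsFkD w then 1 else 0) + plateaus w
  where open import Data.Bool using (if_then_else_)
plateaus (F ∷ w) = plateaus w
plateaus (D ∷ w) = plateaus w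

motzkinTwoPlateaus : List Step → Bool
motzkinTwoPlateaus w = isMotzkin w ∧ (plateaus w ≡ᵇ 2)
  where open import Data.Nat using (_≡ᵇ_)

count2 : ℕ → ℕ
count2 n = length (filter (λ w → T? (motzkinTwoPlateaus w)) (words n))

-- Deleting the flat steps of a Motzkin path yields a Dyck path, and every plateau U Fᵏ D
-- becomes a peak U D.  We do not build this correspondence as a bijection; instead both
-- properties are decided by one automaton `accepts` whose state is (height, number of
-- plateaus still to be seen, whether the last non-flat step was U), and on which F acts as
-- the identity.  Splitting words by their first letter then shows that the number of
-- accepted words of length n is the binomial sum Σₖ C(n,k) · dyck k, where dyck k counts
-- the accepted words of length k over {U, D} alone (`accepted-count`).
--
-- Second, the numbers dyck k are computed along words of length h + 2u from height h:
-- paths with no, one and two peaks are counted by induction on the number u of remaining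
-- up-steps; in particular dyck vanishes at odd lengths and dyck (2m) = C(m,2).
--
-- Finally Σₖ C(n+3,k) f(k) = Σₖ C(n,k) Δ³f(k) for the forward difference Δ, and for our f
-- one has 2 · Δ³f(k) = k(k+1), whose binomial sum is n(n+3) · 2ⁿ⁻².
module Submission where

open import Defs
open import Data.Nat using (ℕ; _≤_; _*_; _∸_; _^_)
open import Relation.Binary.PropositionalEquality using (_≡_)

open import Data.Nat using (zero; suc; _+_; _<_; s≤s; _≡ᵇ_)
open import Data.Nat.Properties using (*-distribˡ-+; n<1+n; m<n⇒m<1+n)
open import Data.Nat.Combinatorics using (_C_; nC1≡n; nCk+nC[k+1]≡[n+1]C[k+1])
open import Data.Nat.Tactic.RingSolver using (solve-∀)
open import Data.Bool using (Bool; true; false; _∧_; if_then_else_)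
open import Data.Bool.Properties using (∧-zeroʳ)
open import Data.List using (List; []; _∷_; length; filter; concatMap)
open import Data.Product using (∃; _,_)
open import Data.Sum using (_⊎_; inj₁; inj₂)
open import Relation.Nullary.Decidable using (T?)
open import Relation.Binary.PropositionalEquality using (refl; sym; trans; cong; cong₂; module ≡-Reasoning)
open ≡-Reasoning

indicator : Bool → ℕ
indicator true  = 1
indicator false = 0

count : (List Step → Bool) → List (List Step) → ℕ
count P []       = 0
count P (w ∷ ws) = indicator (P w) + count P ws

count-filter : ∀ P L → length (filter (λ w → T? (P w)) L) ≡ count P L
count-filter P [] = refl
count-filter P (w ∷ L) with P w
... | true  = cong suc (count-filter P L)
... | false = count-filter P L

count-cong : ∀ {P Q} → (∀ w → P w ≡ Q w) → ∀ L → count P L ≡ count Q L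
count-cong P≡Q []      = refl
count-cong P≡Q (w ∷ L) = cong₂ _+_ (cong indicator (P≡Q w)) (count-cong P≡Q L)

count-never : ∀ L → count (λ _ → false) L ≡ 0
count-never []      = refl
count-never (w ∷ L) = count-never L

extensions : List Step → List (List Step)
extensions w = (U ∷ w) ∷ (F ∷ w) ∷ (D ∷ w) ∷ []

count-extensions : ∀ P L →
  count P (concatMap extensions L) ≡
    count (λ w → P (U ∷ w)) L + count (λ w → P (F ∷ w)) L + count (λ w → P (D ∷ w)) L
count-extensions P [] = refl
count-extensions P (w ∷ L) = begin
    indicator (P (U ∷ w)) + (indicator (P (F ∷ w)) + (indicator (P (D ∷ w)) + count P (concatMap extensions L)))
  ≡⟨ cong (λ z → indicator (P (U ∷ w)) + (indicator (P (F ∷ w)) + (indicator (P (D ∷ w)) + z)))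
          (count-extensions P L) ⟩
    indicator (P (U ∷ w)) + (indicator (P (F ∷ w)) + (indicator (P (D ∷ w)) + (x + y + z)))
  ≡⟨ regroup (indicator (P (U ∷ w))) (indicator (P (F ∷ w))) (indicator (P (D ∷ w))) x y z ⟩
    indicator (P (U ∷ w)) + x + (indicator (P (F ∷ w)) + y) + (indicator (P (D ∷ w)) + z)
  ∎
  where
  x = count (λ w → P (U ∷ w)) L
  y = count (λ w → P (F ∷ w)) L
  z = count (λ w → P (D ∷ w)) L
  regroup : ∀ a b c x y z → a + (b + (c + (x + y + z))) ≡ a + x + (b + y) + (c + z)
  regroup = solve-∀

-- The automaton.  State: current height h, number j of plateaus still required, and
-- whether the last non-flat step was U (so that a following D closes a plateau).
accepts : List Step → ℕ → ℕ → Bool → Bool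
accepts []      zero    zero    up    = true
accepts []      zero    (suc j) up    = false
accepts []      (suc h) j       up    = false
accepts (U ∷ w) h       j       up    = accepts w (suc h) j true
accepts (F ∷ w) h       j       up    = accepts w h j up
accepts (D ∷ w) zero    j       up    = false
accepts (D ∷ w) (suc h) j       false = accepts w h j false
accepts (D ∷ w) (suc h) zero    true  = false
accepts (D ∷ w) (suc h) (suc j) true  = accepts w h j false

plateausAfter : Bool → List Step → ℕ
plateausAfter up w = (if up ∧ startsFkD w then 1 else 0) + plateaus w

accepts-correct : ∀ w h j up → accepts w h j up ≡ (validFrom h w ∧ (plateausAfter up w ≡ᵇ j))
accepts-correct []      zero    zero    false = refl
accepts-correct []      zero    zero    true  = refl
accepts-correct []      zero    (suc j) false = refl
accepts-correct []      zero    (suc j) true  = refl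
accepts-correct []      (suc h) j       false = refl
accepts-correct []      (suc h) j       true  = refl
accepts-correct (U ∷ w) zero    j       false = accepts-correct w 1 j true
accepts-correct (U ∷ w) zero    j       true  = accepts-correct w 1 j true
accepts-correct (U ∷ w) (suc h) j       false = accepts-correct w (suc (suc h)) j true
accepts-correct (U ∷ w) (suc h) j       true  = accepts-correct w (suc (suc h)) j true
accepts-correct (F ∷ w) zero    j       up    = accepts-correct w zero j up
accepts-correct (F ∷ w) (suc h) j       up    = accepts-correct w (suc h) j up
accepts-correct (D ∷ w) zero    j       up    = refl
accepts-correct (D ∷ w) (suc h) j       false = accepts-correct w h j false
accepts-correct (D ∷ w) (suc h) zero    true  = sym (∧-zeroʳ (validFrom h w))
accepts-correct (D ∷ w) (suc h) (suc j) true  = accepts-correct w h j false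

twoPlateaus-accepts : ∀ w → motzkinTwoPlateaus w ≡ accepts w 0 2 false
twoPlateaus-accepts w = sym (accepts-correct w 0 2 false)

-- dyck k h j up: the number of words of length k over {U, D} accepted from the state
-- (h, j, up); dyckDown k h j up counts those accepted after a preceding D.
dyck     : ℕ → ℕ → ℕ → Bool → ℕ
dyckDown : ℕ → ℕ → ℕ → Bool → ℕ
dyck zero    zero    zero    up = 1
dyck zero    zero    (suc j) up = 0
dyck zero    (suc h) j       up = 0
dyck (suc k) h       j       up = dyck k (suc h) j true + dyckDown k h j up
dyckDown k zero    j       up    = 0
dyckDown k (suc h) j       false = dyck k h j false
dyckDown k (suc h) zero    true  = 0
dyckDown k (suc h) (suc j) true  = dyck k h j false

twoPeakCount : ℕ → ℕ
twoPeakCount k = dyck k 0 2 false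

-- binomialSum n f = Σₖ C(n,k) f(k), defined through Pascal's rule.
binomialSum : ℕ → (ℕ → ℕ) → ℕ
binomialSum zero    f = f 0
binomialSum (suc n) f = binomialSum n f + binomialSum n (λ k → f (suc k))

binomialSum-cong : ∀ n {f g : ℕ → ℕ} → (∀ k → f k ≡ g k) → binomialSum n f ≡ binomialSum n g
binomialSum-cong zero    f≡g = f≡g 0
binomialSum-cong (suc n) f≡g = cong₂ _+_ (binomialSum-cong n f≡g) (binomialSum-cong n (λ k → f≡g (suc k)))

binomialSum-+ : ∀ n (f g : ℕ → ℕ) → binomialSum n (λ k → f k + g k) ≡ binomialSum n f + binomialSum n g
binomialSum-+ zero    f g = refl
binomialSum-+ (suc n) f g =
  trans (cong₂ _+_ (binomialSum-+ n f g) (binomialSum-+ n (λ k → f (suc k)) (λ k → g (suc k))))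
        (interchange (binomialSum n f) (binomialSum n g)
                     (binomialSum n (λ k → f (suc k))) (binomialSum n (λ k → g (suc k))))
  where
  interchange : ∀ a b c d → (a + b) + (c + d) ≡ (a + c) + (b + d)
  interchange = solve-∀

binomialSum-scale : ∀ n c (f : ℕ → ℕ) → binomialSum n (λ k → c * f k) ≡ c * binomialSum n f
binomialSum-scale zero    c f = refl
binomialSum-scale (suc n) c f =
  trans (cong₂ _+_ (binomialSum-scale n c f) (binomialSum-scale n c (λ k → f (suc k))))
        (sym (*-distribˡ-+ c (binomialSum n f) (binomialSum n (λ k → f (suc k)))))

binomialSum-zero : ∀ n → binomialSum n (λ _ → 0) ≡ 0
binomialSum-zero zero    = refl
binomialSum-zero (suc n) = cong₂ _+_ (binomialSum-zero n) (binomialSum-zero n)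

-- Flat steps can be inserted anywhere: accepted words of length n are counted by the
-- binomial sum of the accepted U/D-words.
accepted-count :
  ∀ n h j up → count (λ w → accepts w h j up) (words n) ≡ binomialSum n (λ k → dyck k h j up)
accepted-count-down :
  ∀ n h j up → count (λ w → accepts (D ∷ w) h j up) (words n) ≡ binomialSum n (λ k → dyckDown k h j up)
accepted-count zero    zero    zero    up = refl
accepted-count zero    zero    (suc j) up = refl
accepted-count zero    (suc h) j       up = refl
accepted-count (suc n) h j up = begin
    count (λ w → accepts w h j up) (concatMap extensions (words n))
  ≡⟨ count-extensions (λ w → accepts w h j up) (words n) ⟩
    count (λ w → accepts w (suc h) j true) (words n) + count (λ w → accepts w h j up) (words n)
      + count (λ w → accepts (D ∷ w) h j up) (words n)
  ≡⟨ cong₂ _+_ (cong₂ _+_ (accepted-count n (suc h) j true) (accepted-count n h j up))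
               (accepted-count-down n h j up) ⟩
    byUp + byFlat + byDown
  ≡⟨ rotate byUp byFlat byDown ⟩
    byFlat + (byUp + byDown)
  ≡⟨ cong (byFlat +_) (sym (binomialSum-+ n (λ k → dyck k (suc h) j true) (λ k → dyckDown k h j up))) ⟩
    binomialSum (suc n) (λ k → dyck k h j up)
  ∎
  where
  byUp   = binomialSum n (λ k → dyck k (suc h) j true)
  byFlat = binomialSum n (λ k → dyck k h j up)
  byDown = binomialSum n (λ k → dyckDown k h j up)
  rotate : ∀ a b c → a + b + c ≡ b + (a + c)
  rotate = solve-∀
accepted-count-down n zero    j       up    = trans (count-never (words n)) (sym (binomialSum-zero n))
accepted-count-down n (suc h) j       false = accepted-count n h j false
accepted-count-down n (suc h) zero    true  = trans (count-never (words n)) (sym (binomialSum-zero n))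
accepted-count-down n (suc h) (suc j) true  = accepted-count n h j false

count2-binomialSum : ∀ n → count2 n ≡ binomialSum n twoPeakCount
count2-binomialSum n =
  trans (count-filter motzkinTwoPlateaus (words n))
        (trans (count-cong twoPlateaus-accepts (words n)) (accepted-count n 0 2 false))

-- len h u = h + 2u: the length of a U/D-word from height h back to 0 using u up-steps.
-- It is defined so that reading one up-step unfolds it definitionally.
len : ℕ → ℕ → ℕ
len h zero    = h
len h (suc u) = suc (len (suc h) u)

len-suc : ∀ h u → len (suc h) u ≡ suc (len h u)
len-suc h zero    = refl
len-suc h (suc u) = cong suc (len-suc (suc h) u)

len-next : ∀ m → len 0 (suc m) ≡ suc (suc (len 0 m))
len-next m = cong suc (len-suc 0 m)

len-ground : ∀ m → len 0 m ≡ m + m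
len-ground zero    = refl
len-ground (suc m) = begin
  len 0 (suc m)       ≡⟨ len-next m ⟩
  suc (suc (len 0 m)) ≡⟨ cong (λ x → suc (suc x)) (len-ground m) ⟩
  suc (suc (m + m))   ≡⟨ cong suc (lemma m) ⟩
  suc m + suc m       ∎
  where
  lemma : ∀ m → suc (m + m) ≡ m + suc m
  lemma = solve-∀

parity : ∀ k → ∃ (λ m → k ≡ len 0 m) ⊎ ∃ (λ m → k ≡ suc (len 0 m))
parity zero = inj₁ (0 , refl)
parity (suc k) with parity k
... | inj₁ (m , k≡) = inj₂ (m , cong suc k≡)
... | inj₂ (m , k≡) = inj₁ (suc m , trans (cong suc k≡) (sym (len-next m)))

dyckDown-vanish : ∀ {k h} → (∀ j → dyck k h j false ≡ 0) → ∀ j up → dyckDown k (suc h) j up ≡ 0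
dyckDown-vanish vanish j       false = vanish j
dyckDown-vanish vanish zero    true  = refl
dyckDown-vanish vanish (suc j) true  = vanish j

dyck-short : ∀ k h j up → k < h → dyck k h j up ≡ 0
dyck-short zero    (suc h) j up _ = refl
dyck-short (suc k) (suc h) j up (s≤s k<h) =
  cong₂ _+_ (dyck-short k (suc (suc h)) j true (m<n⇒m<1+n (m<n⇒m<1+n k<h)))
            (dyckDown-vanish (λ j → dyck-short k h j false k<h) j up)

-- Length and height must have the same parity.
dyck-odd : ∀ u h j up → dyck (suc (len h u)) h j up ≡ 0
dyck-odd zero    zero    zero    false = refl
dyck-odd zero    zero    zero    true  = refl
dyck-odd zero    zero    (suc j) false = refl
dyck-odd zero    zero    (suc j) true  = refl
dyck-odd zero    (suc h) j       up    =
  cong₂ _+_ (dyck-short (suc h) (suc (suc h)) j true (n<1+n _))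
            (dyckDown-vanish (λ j → dyck-odd zero h j false) j up)
dyck-odd (suc u) zero    j       up    = cong (_+ 0) (dyck-odd u 1 j true)
dyck-odd (suc u) (suc h) j       up    =
  cong₂ _+_ (dyck-odd u (suc (suc h)) j true)
            (dyckDown-vanish (λ j → trans (cong (λ k → dyck (suc k) h j false) (len-suc (suc h) u))
                                          (dyck-odd (suc u) h j false)) j up)

-- With exactly h + 1 steps left at height h + 1, an up-step is fatal.
dyck-tight : ∀ h j up → dyck (suc h) (suc h) j up ≡ dyckDown h (suc h) j up
dyck-tight h j up = cong (_+ dyckDown h (suc h) j up) (dyck-short h (suc (suc h)) j true (m<n⇒m<1+n (n<1+n h)))

dyckDown-len : ∀ h u j up → dyckDown (len (suc (suc h)) u) (suc h) j up ≡ dyckDown (len h (suc u)) (suc h) j up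
dyckDown-len h u j up = cong (λ k → dyckDown k (suc h) j up) (len-suc (suc h) u)

-- No peaks remaining.  Right after an up-step a peak is unavoidable; otherwise the only
-- peak-free path is the straight descent.
noPeak-pending : ∀ h u → dyck (len (suc h) u) (suc h) 0 true ≡ 0
noPeak-pending h zero    = dyck-tight h 0 true
noPeak-pending h (suc u) = cong (_+ 0) (noPeak-pending (suc h) u)

noPeak-descent : ∀ h → dyck h h 0 false ≡ 1
noPeak-descent zero    = refl
noPeak-descent (suc h) = trans (dyck-tight h 0 false) (noPeak-descent h)

noPeak-climb : ∀ h u → dyck (len h (suc u)) h 0 false ≡ 0
noPeak-climb zero    u = cong (_+ 0) (noPeak-pending 0 u)
noPeak-climb (suc h) u = cong₂ _+_ (noPeak-pending (suc h) u) (trans (dyckDown-len h u 0 false) (noPeak-climb h u))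

-- One peak remaining.  Right after an up-step the pending peak must be the last one,
-- leaving one path; otherwise the single peak is reached from one of h + 1 levels.
onePeak-pending : ∀ h u → dyck (len (suc h) u) (suc h) 1 true ≡ 1
onePeak-pending h zero    = trans (dyck-tight h 1 true) (noPeak-descent h)
onePeak-pending h (suc u) = cong₂ _+_ (onePeak-pending (suc h) u) (trans (dyckDown-len h u 1 true) (noPeak-climb h u))

onePeak-descent : ∀ h → dyck h h 1 false ≡ 0
onePeak-descent zero    = refl
onePeak-descent (suc h) = trans (dyck-tight h 1 false) (onePeak-descent h)

onePeak-climb : ∀ h u → dyck (len h (suc u)) h 1 false ≡ suc h
onePeak-climb zero    u = cong (_+ 0) (onePeak-pending 0 u)
onePeak-climb (suc h) u = cong₂ _+_ (onePeak-pending (suc h) u) (trans (dyckDown-len h u 1 false) (onePeak-climb h u))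

choose2-suc : ∀ m → suc m C 2 ≡ m + m C 2
choose2-suc m = trans (sym (nCk+nC[k+1]≡[n+1]C[k+1] m 1)) (cong (_+ m C 2) (nC1≡n m))

-- Two peaks remaining, right after an up-step.  Closing the pending peak now leaves
-- one-peak paths from height h - 1, of which there are h.
twoPeaks-descent : ∀ h → dyck h h 2 true ≡ 0
twoPeaks-descent zero    = refl
twoPeaks-descent (suc h) = trans (dyck-tight h 2 true) (onePeak-descent h)

twoPeaks-closing : ∀ h u → dyckDown (len (suc h) u) h 2 true ≡ h
twoPeaks-closing zero    u = refl
twoPeaks-closing (suc h) u = trans (dyckDown-len h u 2 true) (onePeak-climb h u)

twoPeaks-pending : ∀ h u → dyck (len h u) h 2 true ≡ u * h + u C 2
twoPeaks-pending h zero    = twoPeaks-descent h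
twoPeaks-pending h (suc u) = begin
    dyck (len (suc h) u) (suc h) 2 true + dyckDown (len (suc h) u) h 2 true
  ≡⟨ cong₂ _+_ (twoPeaks-pending (suc h) u) (twoPeaks-closing h u) ⟩
    u * suc h + u C 2 + h
  ≡⟨ arith u h (u C 2) ⟩
    suc u * h + (u + u C 2)
  ≡⟨ cong (suc u * h +_) (sym (choose2-suc u)) ⟩
    suc u * h + suc u C 2
  ∎
  where
  arith : ∀ u h c → u * suc h + c + h ≡ suc u * h + (u + c)
  arith = solve-∀

twoPeakCount-even : ∀ m → twoPeakCount (len 0 m) ≡ m C 2
twoPeakCount-even zero    = refl
twoPeakCount-even (suc u) = begin
    dyck (len 1 u) 1 2 true + 0 ≡⟨ cong (_+ 0) (twoPeaks-pending 1 u) ⟩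
    u * 1 + u C 2 + 0           ≡⟨ arith u (u C 2) ⟩
    u + u C 2                   ≡⟨ sym (choose2-suc u) ⟩
    suc u C 2                   ∎
  where
  arith : ∀ u c → u * 1 + c + 0 ≡ u + c
  arith = solve-∀

twoPeakCount-odd : ∀ m → twoPeakCount (suc (len 0 m)) ≡ 0
twoPeakCount-odd m = dyck-odd m 0 2 false

-- C(m,2) = m(m-1)/2, stated without subtraction or division.
choose2-double : ∀ m → 2 * (m C 2) + m ≡ m * m
choose2-double zero    = refl
choose2-double (suc m) = begin
    2 * (suc m C 2) + suc m     ≡⟨ cong (λ c → 2 * c + suc m) (choose2-suc m) ⟩
    2 * (m + m C 2) + suc m     ≡⟨ arith m (m C 2) ⟩
    (2 * (m C 2) + m) + 2 * m + 1 ≡⟨ cong (λ x → x + 2 * m + 1) (choose2-double m) ⟩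
    m * m + 2 * m + 1           ≡⟨ square m ⟩
    suc m * suc m               ∎
  where
  arith : ∀ m c → 2 * (m + c) + suc m ≡ (2 * c + m) + 2 * m + 1
  arith = solve-∀
  square : ∀ m → m * m + 2 * m + 1 ≡ suc m * suc m
  square = solve-∀

Δ : (ℕ → ℕ) → ℕ → ℕ
Δ g k = g k + g (suc k)

Δ³ : (ℕ → ℕ) → ℕ → ℕ
Δ³ g = Δ (Δ (Δ g))

binomialSum-Δ : ∀ n g → binomialSum (suc n) g ≡ binomialSum n (Δ g)
binomialSum-Δ n g = sym (binomialSum-+ n g (λ k → g (suc k)))

binomialSum-Δ³ : ∀ n g → binomialSum (suc (suc (suc n))) g ≡ binomialSum n (Δ³ g)
binomialSum-Δ³ n g =
  trans (binomialSum-Δ (suc (suc n)) g) (trans (binomialSum-Δ (suc n) (Δ g)) (binomialSum-Δ n (Δ (Δ g))))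

cubicWeights : ℕ → ℕ → ℕ → ℕ → ℕ
cubicWeights a b c d = a + 3 * b + 3 * c + d

cubicWeights-cong : ∀ {a b c d a′ b′ c′ d′} → a ≡ a′ → b ≡ b′ → c ≡ c′ → d ≡ d′ →
                    cubicWeights a b c d ≡ cubicWeights a′ b′ c′ d′
cubicWeights-cong refl refl refl refl = refl

Δ³-expand : ∀ g k → Δ³ g k ≡ cubicWeights (g k) (g (suc k)) (g (suc (suc k))) (g (suc (suc (suc k))))
Δ³-expand g k = arith (g k) (g (suc k)) (g (suc (suc k))) (g (suc (suc (suc k))))
  where
  arith : ∀ a b c d → ((a + b) + (b + c)) + ((b + c) + (c + d)) ≡ a + 3 * b + 3 * c + d
  arith = solve-∀

pronic : ℕ → ℕ
pronic k = k * suc k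

twoPeakCount-Δ³ : ∀ k → 2 * Δ³ twoPeakCount k ≡ pronic k
twoPeakCount-Δ³ k with parity k
... | inj₁ (m , refl) = begin
    2 * Δ³ f L
  ≡⟨ cong (2 *_) (Δ³-expand f L) ⟩
    2 * cubicWeights (f L) (f (suc L)) (f (suc (suc L))) (f (suc (suc (suc L))))
  ≡⟨ cong (λ x → 2 * cubicWeights (f L) (f (suc L)) (f x) (f (suc x))) (sym (len-next m)) ⟩
    2 * cubicWeights (f L) (f (suc L)) (f (len 0 (suc m))) (f (suc (len 0 (suc m))))
  ≡⟨ cong (2 *_) (cubicWeights-cong (twoPeakCount-even m) (twoPeakCount-odd m)
                                    (twoPeakCount-even (suc m)) (twoPeakCount-odd (suc m))) ⟩
    2 * cubicWeights (m C 2) 0 (suc m C 2) 0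
  ≡⟨ cong (λ c → 2 * cubicWeights (m C 2) 0 c 0) (choose2-suc m) ⟩
    2 * (m C 2 + 3 * 0 + 3 * (m + m C 2) + 0)
  ≡⟨ arith m (m C 2) ⟩
    4 * (2 * (m C 2) + m) + 2 * m
  ≡⟨ cong (λ x → 4 * x + 2 * m) (choose2-double m) ⟩
    4 * (m * m) + 2 * m
  ≡⟨ factor m ⟩
    (m + m) * suc (m + m)
  ≡⟨ cong (λ x → x * suc x) (sym (len-ground m)) ⟩
    L * suc L
  ∎
  where
  f = twoPeakCount
  L = len 0 m
  arith : ∀ m c → 2 * (c + 3 * 0 + 3 * (m + c) + 0) ≡ 4 * (2 * c + m) + 2 * m
  arith = solve-∀
  factor : ∀ m → 4 * (m * m) + 2 * m ≡ (m + m) * suc (m + m)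
  factor = solve-∀
... | inj₂ (m , refl) = begin
    2 * Δ³ f (suc L)
  ≡⟨ cong (2 *_) (Δ³-expand f (suc L)) ⟩
    2 * cubicWeights (f (suc L)) (f (suc (suc L))) (f (suc (suc (suc L)))) (f (suc (suc (suc (suc L)))))
  ≡⟨ cong (λ x → 2 * cubicWeights (f (suc L)) (f x) (f (suc x)) (f (suc (suc x)))) (sym (len-next m)) ⟩
    2 * cubicWeights (f (suc L)) (f L′) (f (suc L′)) (f (suc (suc L′)))
  ≡⟨ cong (λ x → 2 * cubicWeights (f (suc L)) (f L′) (f (suc L′)) (f x)) (sym (len-next (suc m))) ⟩
    2 * cubicWeights (f (suc L)) (f L′) (f (suc L′)) (f (len 0 (suc (suc m))))
  ≡⟨ cong (2 *_) (cubicWeights-cong (twoPeakCount-odd m) (twoPeakCount-even (suc m))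
                                    (twoPeakCount-odd (suc m)) (twoPeakCount-even (suc (suc m)))) ⟩
    2 * cubicWeights 0 (suc m C 2) 0 (suc (suc m) C 2)
  ≡⟨ cong₂ (λ b d → 2 * cubicWeights 0 b 0 d) (choose2-suc m)
           (trans (choose2-suc (suc m)) (cong (suc m +_) (choose2-suc m))) ⟩
    2 * (0 + 3 * (m + m C 2) + 3 * 0 + (suc m + (m + m C 2)))
  ≡⟨ arith m (m C 2) ⟩
    4 * (2 * (m C 2) + m) + (6 * m + 2)
  ≡⟨ cong (λ x → 4 * x + (6 * m + 2)) (choose2-double m) ⟩
    4 * (m * m) + (6 * m + 2)
  ≡⟨ factor m ⟩
    suc (m + m) * suc (suc (m + m))
  ≡⟨ cong (λ x → suc x * suc (suc x)) (sym (len-ground m)) ⟩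
    suc L * suc (suc L)
  ∎
  where
  f = twoPeakCount
  L = len 0 m
  L′ = len 0 (suc m)
  arith : ∀ m c → 2 * (0 + 3 * (m + c) + 3 * 0 + (suc m + (m + c))) ≡ 4 * (2 * c + m) + (6 * m + 2)
  arith = solve-∀
  factor : ∀ m → 4 * (m * m) + (6 * m + 2) ≡ suc (m + m) * suc (suc (m + m))
  factor = solve-∀

binomialSum-one : ∀ n → binomialSum n (λ _ → 1) ≡ 2 ^ n
binomialSum-one zero    = refl
binomialSum-one (suc n) = trans (cong₂ _+_ (binomialSum-one n) (binomialSum-one n)) (double (2 ^ n))
  where
  double : ∀ p → p + p ≡ 2 * p
  double = solve-∀

binomialSum-suc : ∀ n → 2 * binomialSum n suc ≡ (n + 2) * 2 ^ n
binomialSum-suc zero    = refl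
binomialSum-suc (suc n) = begin
    2 * (S + binomialSum n (λ k → suc (suc k)))
  ≡⟨ cong (λ x → 2 * (S + x)) (binomialSum-+ n (λ _ → 1) suc) ⟩
    2 * (S + (binomialSum n (λ _ → 1) + S))
  ≡⟨ cong (λ x → 2 * (S + (x + S))) (binomialSum-one n) ⟩
    2 * (S + (2 ^ n + S))
  ≡⟨ regroup S (2 ^ n) ⟩
    2 * (2 * S) + 2 * 2 ^ n
  ≡⟨ cong (λ x → 2 * x + 2 * 2 ^ n) (binomialSum-suc n) ⟩
    2 * ((n + 2) * 2 ^ n) + 2 * 2 ^ n
  ≡⟨ arith n (2 ^ n) ⟩
    (suc n + 2) * (2 * 2 ^ n)
  ∎
  where
  S = binomialSum n suc
  regroup : ∀ s p → 2 * (s + (p + s)) ≡ 2 * (2 * s) + 2 * p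
  regroup = solve-∀
  arith : ∀ n p → 2 * ((n + 2) * p) + 2 * p ≡ (suc n + 2) * (2 * p)
  arith = solve-∀

binomialSum-pronic : ∀ n → 4 * binomialSum n pronic ≡ n * (n + 3) * 2 ^ n
binomialSum-pronic zero    = refl
binomialSum-pronic (suc n) = begin
    4 * (B + binomialSum n (λ k → pronic (suc k)))
  ≡⟨ cong (λ x → 4 * (B + x)) (trans (binomialSum-cong n pronic-suc) (binomialSum-+ n pronic (λ k → suc k + suc k))) ⟩
    4 * (B + (B + binomialSum n (λ k → suc k + suc k)))
  ≡⟨ cong (λ x → 4 * (B + (B + x))) (binomialSum-+ n suc suc) ⟩
    4 * (B + (B + (S + S)))
  ≡⟨ regroup B S ⟩
    2 * (4 * B) + 4 * (2 * S)
  ≡⟨ cong₂ (λ x y → 2 * x + 4 * y) (binomialSum-pronic n) (binomialSum-suc n) ⟩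
    2 * (n * (n + 3) * 2 ^ n) + 4 * ((n + 2) * 2 ^ n)
  ≡⟨ arith n (2 ^ n) ⟩
    suc n * (suc n + 3) * (2 * 2 ^ n)
  ∎
  where
  B = binomialSum n pronic
  S = binomialSum n suc
  pronic-suc : ∀ k → suc k * suc (suc k) ≡ k * suc k + (suc k + suc k)
  pronic-suc = solve-∀
  regroup : ∀ b s → 4 * (b + (b + (s + s))) ≡ 2 * (4 * b) + 4 * (2 * s)
  regroup = solve-∀
  arith : ∀ n p → 2 * (n * (n + 3) * p) + 4 * ((n + 2) * p) ≡ suc n * (suc n + 3) * (2 * p)
  arith = solve-∀

corollary14 : (n : ℕ) → 3 ≤ n → 2 ^ 6 * count2 n ≡ (n ∸ 3) * n * 2 ^ n
corollary14 zero                ()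
corollary14 (suc zero)          (s≤s ())
corollary14 (suc (suc zero))    (s≤s (s≤s ()))
corollary14 (suc (suc (suc n))) _ = begin
    64 * count2 (3 + n)
  ≡⟨ cong (64 *_) (trans (count2-binomialSum (3 + n)) (binomialSum-Δ³ n twoPeakCount)) ⟩
    64 * X
  ≡⟨ regroup X ⟩
    8 * (4 * (2 * X))
  ≡⟨ cong (λ x → 8 * (4 * x)) (sym (binomialSum-scale n 2 (Δ³ twoPeakCount))) ⟩
    8 * (4 * binomialSum n (λ k → 2 * Δ³ twoPeakCount k))
  ≡⟨ cong (λ x → 8 * (4 * x)) (binomialSum-cong n twoPeakCount-Δ³) ⟩
    8 * (4 * binomialSum n pronic)
  ≡⟨ cong (8 *_) (binomialSum-pronic n) ⟩
    8 * (n * (n + 3) * 2 ^ n)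
  ≡⟨ arith n (2 ^ n) ⟩
    n * (3 + n) * (2 * (2 * (2 * 2 ^ n)))
  ∎
  where
  X = binomialSum n (Δ³ twoPeakCount)
  regroup : ∀ x → 64 * x ≡ 8 * (4 * (2 * x))
  regroup = solve-∀
  arith : ∀ n p → 8 * (n * (n + 3) * p) ≡ n * (3 + n) * (2 * (2 * (2 * p)))
  arith = solve-∀
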